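{- Let $G$ be a $2$-connected embedded graph, let $(D,\gamma)$ be a bond-carving decomposition of its dual $\delta(G)$, and let $\rho'$ and $\rho''$ be the two children of the root $\rho$ of $D$. Then $I_{\rho'} = I_{\rho''}$.
   Context: The dual $\delta(G)$ of an embedded (planar, fixed combinatorial embedding) graph $G$ has a vertex per face of $G$ and an edge per edge of $G$ joining the two faces on its sides. A bond-carving decomposition of a graph $H$ is a pair $(D,\gamma)$ where $D$ is a rooted binary tree whose leaves are the vertices of $H$ and, for each non-root node $\nu$, $\gamma(\nu)$ is the set of edges of $H$ with exactly one endpoint in the leaf set $\mathcal L_\nu$ of the subtree of $D$ rooted at $\nu$, such that every $\gamma(\nu)$ is a bond ($H[\mathcal L_\nu]$ and $H[V(H)\setminus\mathcal L_\nu]$ are both nonempty and connected). For a non-root node $\nu$, $F_\nu$ is the set of faces of $G$ corresponding to the leaves of the subtree of $D$ rooted at $\nu$, $G_\nu$ is the embedded subgraph of $G$ induced by the edges of the faces in $F_\nu$, and the interface graph $I_\nu$ is the subgraph of $G_\nu$ induced by the edges of $G_\nu$ that are incident to a face of $G_\nu$ not in $F_\nu$. -}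

module Defs where

open import Data.Nat using (ℕ; zero; suc; _+_; _≤_; _<_)
open import Data.Fin using (Fin; _≟_)
open import Data.Bool using (Bool; true; false; not; if_then_else_)
open import Data.Product using (Σ; ∃; ∃-syntax; _×_; _,_; proj₁; proj₂)
open import Data.Sum using (_⊎_)
open import Data.Empty using (⊥)
open import Data.Unit using (⊤)
open import Relation.Nullary using (¬_; does)
open import Relation.Binary.PropositionalEquality using (_≡_)

iter : {A : Set} → ℕ → (A → A) → A → A
iter zero    f x = x
iter (suc k) f x = f (iter k f x)

SameOrbit : {A : Set} → (A → A) → A → A → Set
SameOrbit π d d' = ∃[ k ] iter k π d ≡ d'

data Reach {V : Set} (Adj : V → V → Set) (P : V → Set) : V → V → Set where
  here : ∀ {v} → Reach Adj P v v
  step : ∀ {u v w} → Adj u v → P v → Reach Adj P v w → Reach Adj P u w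

ConnectedOn : {V : Set} → (V → V → Set) → (V → Set) → Set
ConnectedOn {V} Adj P =
  (∃[ v ] P v) × (∀ u v → P u → P v → Reach Adj P u v)

-- Embedded (planar) graphs as combinatorial maps.
-- Edges are Fin m; every edge e has two darts (e , false) and (e , true).
-- tail d is the vertex at which dart d starts, α reverses a dart,
-- σ is the rotation system (cyclic order of darts around each vertex),
-- φ = σ ∘ α is the face permutation; faces are the φ-orbits.

Dart : ℕ → Set
Dart m = Fin m × Bool

α : ∀ {m} → Dart m → Dart m
α (e , b) = e , not b

record EmbeddedGraph : Set where
  field
    n m      : ℕ
    tail     : Dart m → Fin n
    σ σ⁻     : Dart m → Dart m
    σσ⁻      : ∀ d → σ (σ⁻ d) ≡ d
    σ⁻σ      : ∀ d → σ⁻ (σ d) ≡ d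
    σ-vertex₁ : ∀ d d' → tail d ≡ tail d' → SameOrbit σ d d'
    σ-vertex₂ : ∀ d d' → SameOrbit σ d d' → tail d ≡ tail d'
    numFaces : ℕ
    face     : Dart m → Fin numFaces
    face-surj : ∀ f → ∃[ d ] face d ≡ f
    face₁    : ∀ d d' → face d ≡ face d' → SameOrbit (λ x → σ (α x)) d d'
    face₂    : ∀ d d' → SameOrbit (λ x → σ (α x)) d d' → face d ≡ face d'

  φ : Dart m → Dart m
  φ d = σ (α d)

  Adj : Fin n → Fin n → Set
  Adj u v = ∃[ e ] ((tail (e , false) ≡ u × tail (e , true) ≡ v)
                   ⊎ (tail (e , true) ≡ u × tail (e , false) ≡ v))

  Connected : Set
  Connected = ConnectedOn Adj (λ _ → ⊤)

  -- planarity: the (connected) map has Euler genus 0, i.e. V - E + F = 2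
  Planar : Set
  Planar = Connected × (n + numFaces ≡ m + 2)

  TwoConnected : Set
  TwoConnected = (2 < n) × Connected × (∀ x → ConnectedOn Adj (λ v → ¬ v ≡ x))

  DualAdj : Fin numFaces → Fin numFaces → Set
  DualAdj f g = ∃[ e ] ((face (e , false) ≡ f × face (e , true) ≡ g)
                       ⊎ (face (e , true) ≡ f × face (e , false) ≡ g))

data Tree (A : Set) : Set where
  leaf : A → Tree A
  node : Tree A → Tree A → Tree A

data InLeaves {A : Set} (x : A) : Tree A → Set where
  here  : InLeaves x (leaf x)
  left  : ∀ {l r} → InLeaves x l → InLeaves x (node l r)
  right : ∀ {l r} → InLeaves x r → InLeaves x (node l r)

countLeaf : ∀ {k} → Fin k → Tree (Fin k) → ℕ
countLeaf x (leaf y)   = if does (x ≟ y) then 1 else 0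
countLeaf x (node l r) = countLeaf x l + countLeaf x r

-- s is a proper subtree of t (i.e. s is rooted at a non-root node of t)
data _⊏_ {A : Set} (s : Tree A) : Tree A → Set where
  isLeft  : ∀ {r} → s ⊏ node s r
  isRight : ∀ {l} → s ⊏ node l s
  inLeft  : ∀ {l r} → s ⊏ l → s ⊏ node l r
  inRight : ∀ {l r} → s ⊏ r → s ⊏ node l r

module _ (G : EmbeddedGraph) where
  open EmbeddedGraph G

  -- D is a bond-carving decomposition of δ(G): its leaves are exactly the
  -- faces (each exactly once) and for every non-root node ν, γ(ν) is a bond,
  -- i.e. δ(G)[L_ν] and δ(G)[V(δ(G)) ∖ L_ν] are nonempty and connected.
  -- (γ(ν) is determined by D, so it is not carried as separate data.)
  IsBondCarving : Tree (Fin numFaces) → Set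
  IsBondCarving D =
    (∀ f → countLeaf f D ≡ 1) ×
    (∀ ν → ν ⊏ D →
       ConnectedOn DualAdj (λ f → InLeaves f ν) ×
       ConnectedOn DualAdj (λ f → ¬ InLeaves f ν))

  module _ (ν : Tree (Fin numFaces)) where

    InF : Fin numFaces → Set
    InF f = InLeaves f ν

    EdgeOfG : Fin m → Set
    EdgeOfG e = InF (face (e , false)) ⊎ InF (face (e , true))

    -- rotation system of the embedded subgraph G_ν (restriction of σ):
    -- σν d d' : d' is the first dart σ^k d (k ≥ 1) whose edge is in G_ν
    σν : Dart m → Dart m → Set
    σν d d' = ∃[ k ] ((iter (suc k) σ d ≡ d') × EdgeOfG (proj₁ d')
                     × (∀ j → j < k → ¬ EdgeOfG (proj₁ (iter (suc j) σ d))))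

    φν : Dart m → Dart m → Set
    φν d d' = σν (α d) d'

    data SameFaceν (d : Dart m) : Dart m → Set where
      refl' : SameFaceν d d
      next  : ∀ {d' d''} → SameFaceν d d' → φν d' d'' → SameFaceν d d''

    -- the face of G_ν containing dart d is a face of G belonging to F_ν
    FaceInF : Dart m → Set
    FaceInF d = ∃[ f ] (InF f × (∀ d' → (SameFaceν d d' → face d' ≡ f)
                                    × (face d' ≡ f → SameFaceν d d')))

    -- edges of the interface graph I_ν: edges of G_ν incident to a face of
    -- G_ν not in F_ν (I_ν is the subgraph induced by these edges)
    EdgeOfI : Fin m → Set
    EdgeOfI e = EdgeOfG e × (¬ FaceInF (e , false) ⊎ ¬ FaceInF (e , true))

module Submission where

-- The two children ρ', ρ'' of the root split the faces of G:
-- every face is a leaf of exactly one of them.  For any node ν, a face of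
-- the subgraph G_ν that contains a dart whose G-face lies in F_ν is that
-- very G-face: walking along the face permutation φ of G never leaves the
-- face, and every dart met there has its edge in G_ν, so the restricted
-- face successor φ_ν agrees with φ.  Hence "the G_ν-face through dart d
-- belongs to F_ν" is equivalent to "face d ∈ F_ν", and an edge e lies in
-- I_ν exactly when its two sides straddle F_ν: one side is in F_ν, one is
-- not.  Straddling a set is the same as straddling its complement, so
-- I_ρ' = I_ρ''.

open import Defs
open import Data.Fin using (Fin; _≟_)
open import Data.Bool using (true; false)
open import Function using (_∘′_)
open import Data.Product using (_×_; _,_; proj₁)
open import Data.Sum using (_⊎_; inj₁; inj₂; [_,_]′)
open import Data.Sum.Base using () renaming (map to ⊎-map)
open import Data.Nat using (ℕ; suc; _+_; _≤_; z≤n; s≤s)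
open import Data.Nat.Properties using (≤-trans; m≤m+n; m≤n+m; +-mono-≤)
open import Data.Empty using (⊥-elim)
open import Relation.Nullary using (¬_; Dec; yes; no)
open import Relation.Binary.PropositionalEquality
  using (_≡_; refl; sym; trans; cong₂; subst)

record Complementary {A : Set} (P Q : A → Set) : Set where
  field
    disjoint : ∀ x → P x → ¬ Q x
    cover    : ∀ x → P x ⊎ Q x

complementary-sym : {A : Set} {P Q : A → Set} →
                    Complementary P Q → Complementary Q P
complementary-sym c = record
  { disjoint = λ x q p → disjoint x p q
  ; cover    = λ x → [ inj₂ , inj₁ ]′ (cover x) }
  where open Complementary c

Straddles : {A : Set} → (A → Set) → A → A → Set
Straddles P a b = (P a ⊎ P b) × (¬ P a ⊎ ¬ P b)

straddles-complement : {A : Set} {P Q : A → Set} → Complementary P Q →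
                       ∀ {a b} → Straddles P a b → Straddles Q a b
straddles-complement {P = P} {Q} c (some , notAll) =
  ⊎-map (not-P⇒Q _) (not-P⇒Q _) notAll , ⊎-map (P⇒not-Q _) (P⇒not-Q _) some
  where
  open Complementary c
  P⇒not-Q : ∀ x → P x → ¬ Q x
  P⇒not-Q = disjoint
  not-P⇒Q : ∀ x → ¬ P x → Q x
  not-P⇒Q x ¬p = [ (λ p → ⊥-elim (¬p p)) , (λ q → q) ]′ (cover x)

module _ {k : ℕ} where

  InLeaves? : (f : Fin k) (t : Tree (Fin k)) → Dec (InLeaves f t)
  InLeaves? f (leaf y) with f ≟ y
  ... | yes refl = yes here
  ... | no f≢y   = no λ { here → f≢y refl }
  InLeaves? f (node l r) with InLeaves? f l | InLeaves? f r
  ... | yes p | _     = yes (left p)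
  ... | no _  | yes q = yes (right q)
  ... | no ¬p | no ¬q = no λ { (left p) → ¬p p ; (right q) → ¬q q }

  InLeaves⇒count≥1 : ∀ {f : Fin k} {t} → InLeaves f t → 1 ≤ countLeaf f t
  InLeaves⇒count≥1 {f} here with f ≟ f
  ... | yes _ = s≤s z≤n
  ... | no f≢f = ⊥-elim (f≢f refl)
  InLeaves⇒count≥1 {f} {node l r} (left p) =
    ≤-trans (InLeaves⇒count≥1 p) (m≤m+n (countLeaf f l) (countLeaf f r))
  InLeaves⇒count≥1 {f} {node l r} (right p) =
    ≤-trans (InLeaves⇒count≥1 p) (m≤n+m (countLeaf f r) (countLeaf f l))

  ∉Leaves⇒count≡0 : ∀ {f : Fin k} t → ¬ InLeaves f t → countLeaf f t ≡ 0
  ∉Leaves⇒count≡0 {f} (leaf y) ∉ with f ≟ y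
  ... | yes refl = ⊥-elim (∉ here)
  ... | no _     = refl
  ∉Leaves⇒count≡0 (node l r) ∉ =
    cong₂ _+_ (∉Leaves⇒count≡0 l (λ p → ∉ (left p)))
              (∉Leaves⇒count≡0 r (λ q → ∉ (right q)))

  children-complementary : ∀ l r → (∀ f → countLeaf f (node l r) ≡ 1) →
    Complementary (λ f → InLeaves f l) (λ f → InLeaves f r)
  children-complementary l r once = record { disjoint = disjoint ; cover = cover }
    where
    disjoint : ∀ f → InLeaves f l → ¬ InLeaves f r
    disjoint f p q with subst (2 ≤_) (once f)
                          (+-mono-≤ (InLeaves⇒count≥1 p) (InLeaves⇒count≥1 q))
    ... | s≤s ()
    cover : ∀ f → InLeaves f l ⊎ InLeaves f r
    cover f with InLeaves? f l | InLeaves? f r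
    ... | yes p | _     = inj₁ p
    ... | no _  | yes q = inj₂ q
    ... | no ¬p | no ¬q
      with trans (sym (once f)) (cong₂ _+_ (∉Leaves⇒count≡0 l ¬p) (∉Leaves⇒count≡0 r ¬q))
    ... | ()

module FacesOfSubgraph (G : EmbeddedGraph) (ν : Tree (Fin (EmbeddedGraph.numFaces G))) where
  open EmbeddedGraph G

  dart-in-G : ∀ (d : Dart m) → InF G ν (face d) → EdgeOfG G ν (proj₁ d)
  dart-in-G (e , false) p = inj₁ p
  dart-in-G (e , true)  p = inj₂ p

  face-φ : ∀ d → face (φ d) ≡ face d
  face-φ d = sym (face₂ d (φ d) (1 , refl))

  face-iter-φ : ∀ d k → face (iter k φ d) ≡ face d
  face-iter-φ d k = sym (face₂ d (iter k φ d) (k , refl))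

  -- On a face of F_ν the successor of G_ν is that of G: φ d is in G_ν.
  φν-φ : ∀ d → InF G ν (face d) → φν G ν d (φ d)
  φν-φ d p = 0 , refl , dart-in-G (φ d) (subst (InF G ν) (sym (face-φ d)) p) , λ _ ()

  -- ... and it is the only one: skipping φ d would skip an edge of G_ν.
  φν-unique : ∀ {d d'} → InF G ν (face d) → φν G ν d d' → d' ≡ φ d
  φν-unique p (0 , σαd≡d' , _ , _) = sym σαd≡d'
  φν-unique {d} p (suc _ , _ , _ , skipped) =
    ⊥-elim (skipped 0 (s≤s z≤n) (dart-in-G (φ d) (subst (InF G ν) (sym (face-φ d)) p)))

  φ-orbit⊆faceν : ∀ d → InF G ν (face d) → ∀ k → SameFaceν G ν d (iter k φ d)
  φ-orbit⊆faceν d p 0       = refl'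
  φ-orbit⊆faceν d p (suc k) = next (φ-orbit⊆faceν d p k)
    (φν-φ (iter k φ d) (subst (InF G ν) (sym (face-iter-φ d k)) p))

  faceν⊆face : ∀ d → InF G ν (face d) → ∀ {d'} → SameFaceν G ν d d' → face d' ≡ face d
  faceν⊆face d p refl' = refl
  faceν⊆face d p (next {d'} s d'↦d'') with faceν⊆face d p s
  ... | fd'≡fd with φν-unique (subst (InF G ν) (sym fd'≡fd) p) d'↦d''
  ... | refl = trans (face-φ d') fd'≡fd

  FaceInF⇒InF : ∀ d → FaceInF G ν d → InF G ν (face d)
  FaceInF⇒InF d (f , f∈F , same) = subst (InF G ν) (sym (proj₁ (same d) refl')) f∈F

  InF⇒FaceInF : ∀ d → InF G ν (face d) → FaceInF G ν d
  InF⇒FaceInF d p = face d , p , λ d' →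
    faceν⊆face d p ,
    λ fd'≡fd → let (k , φᵏd≡d') = face₁ d d' (sym fd'≡fd)
               in subst (SameFaceν G ν d) φᵏd≡d' (φ-orbit⊆faceν d p k)

  EdgeOfI⇒Straddles : ∀ e → EdgeOfI G ν e →
    Straddles (InF G ν) (face (e , false)) (face (e , true))
  EdgeOfI⇒Straddles e (inG , outside) =
    inG , ⊎-map (λ ¬F p → ¬F (InF⇒FaceInF _ p)) (λ ¬F p → ¬F (InF⇒FaceInF _ p)) outside

  Straddles⇒EdgeOfI : ∀ e →
    Straddles (InF G ν) (face (e , false)) (face (e , true)) → EdgeOfI G ν e
  Straddles⇒EdgeOfI e (inG , outside) =
    inG , ⊎-map (λ ∉ F → ∉ (FaceInF⇒InF _ F)) (λ ∉ F → ∉ (FaceInF⇒InF _ F)) outside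

interface-complement : (G : EmbeddedGraph) (ν μ : Tree (Fin (EmbeddedGraph.numFaces G))) →
  Complementary (InF G ν) (InF G μ) → ∀ e → EdgeOfI G ν e → EdgeOfI G μ e
interface-complement G ν μ c e =
  FacesOfSubgraph.Straddles⇒EdgeOfI G μ e ∘′ straddles-complement c ∘′
  FacesOfSubgraph.EdgeOfI⇒Straddles G ν e

lemma12 : (G : EmbeddedGraph) → EmbeddedGraph.Planar G → EmbeddedGraph.TwoConnected G →
    (ρ' ρ'' : Tree (Fin (EmbeddedGraph.numFaces G))) → IsBondCarving G (node ρ' ρ'') →
    ∀ e → (EdgeOfI G ρ' e → EdgeOfI G ρ'' e) × (EdgeOfI G ρ'' e → EdgeOfI G ρ' e)
lemma12 G _ _ ρ' ρ'' (once , _) e =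
  interface-complement G ρ' ρ'' split e ,
  interface-complement G ρ'' ρ' (complementary-sym split) e
  where
  split : Complementary (InF G ρ') (InF G ρ'')
  split = children-complementary ρ' ρ'' once
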